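{- For all modal trees $\mathtt{T},\mathtt{S}$: if $\mathtt{T}\hookrightarrow^{\mathsf{J}}\circ\hookrightarrow^{\pi^+*}\mathtt{S}$, then $\mathtt{T}\hookrightarrow^{\pi^+*}\circ\hookrightarrow^{\mathsf{J}*}\circ\hookrightarrow^{\sigma*}\mathtt{S}$.
   Context: Modal trees: recursively, pairs $\langle\Delta;\Gamma\rangle$ with $\Delta$ a finite list of propositional variables and $\Gamma$ a finite list of pairs $(\alpha,\mathtt{S})$, $\alpha<\omega$, $\mathtt{S}$ a modal tree. Positions: $\mathrm{Pos}(\langle\Delta;\varnothing\rangle)=\{\epsilon\}$; $\mathrm{Pos}(\langle\Delta;[(\alpha_1,\mathtt{S}_1),\dots,(\alpha_n,\mathtt{S}_n)]\rangle)=\{\epsilon\}\cup\bigcup_{i=1}^n\{i\mathbf{k}\mid\mathbf{k}\in\mathrm{Pos}(\mathtt{S}_i)\}$. Subtree: $\mathtt{T}|_\epsilon=\mathtt{T}$, $\mathtt{T}|_{i\mathbf{r}}=\mathtt{S}_i|_{\mathbf{r}}$. Replacement: $\mathtt{T}[\mathtt{S}]_\epsilon=\mathtt{S}$, $\mathtt{T}[\mathtt{S}]_{i\mathbf{r}}$ is $\mathtt{T}$ with its $i$-th child $\mathtt{S}_i$ replaced by $\mathtt{S}_i[\mathtt{S}]_{\mathbf{r}}$ (same edge label). List operations, for $0<i,j\le|\Gamma|$: $\#_i\Gamma$ is the $i$-th element; $\Gamma^{ -i}$ deletes it; $\Gamma^{+i}=(\#_i\Gamma)\frown\Gamma$; $\Gamma[x]_i$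 replaces the $i$-th element by $x$; $\Gamma^{i\leftrightarrow j}$ swaps the $i$-th and $j$-th elements. Rules (for a modal tree $\mathtt{T}$, $\mathbf{k}\in\mathrm{Pos}(\mathtt{T})$, $\mathtt{T}|_\mathbf{k}=\langle\Delta;\Gamma\rangle$): ($\sigma$) $\mathtt{T}\hookrightarrow^{\sigma}\mathtt{T}[\langle\Delta;\Gamma^{i\leftrightarrow j}\rangle]_\mathbf{k}$, $i\ne j$; ($\pi^+$) $\mathtt{T}\hookrightarrow^{\pi^+}\mathtt{T}[\langle\Delta;\Gamma^{+i}\rangle]_\mathbf{k}$; ($\mathsf{J}$) if $i\ne j$, $\#_i\Gamma=(\alpha,\langle\tilde\Delta;\tilde\Gamma\rangle)$, $\#_j\Gamma=(\beta,\mathtt{S})$, $\alpha>\beta$, then $\mathtt{T}\hookrightarrow^{\mathsf{J}}\mathtt{T}[\langle\Delta;(\Gamma[(\alpha,\langle\tilde\Delta;\tilde\Gamma\frown(\beta,\mathtt{S})\rangle)]_i)^{ -j}\rangle]_\mathbf{k}$. Notation: $\mathtt{T}\hookrightarrow^{\mu_1}\circ\hookrightarrow^{\mu_2}\mathtt{S}$ means there is $\mathtt{U}$ with $\mathtt{T}\hookrightarrow^{\mu_1}\mathtt{U}\hookrightarrow^{\mu_2}\mathtt{S}$; $\hookrightarrow^{\mu*}$ means zero or more applications of rule $\mu$. -}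

module Defs where

open import Data.Nat using (ℕ; _>_)
open import Data.Product using (_×_; _,_; Σ; ∃)
open import Data.Nat using (suc)
open import Data.List using (List; []; _∷_; _++_; [_]; length; lookup; removeAt; updateAt; tabulate)
open import Data.Fin using (Fin; zero; suc; cast)
import Data.Fin
open import Relation.Nullary using (yes; no)
open import Relation.Binary.PropositionalEquality using (_≡_; _≢_; refl; cong; sym)
open import Relation.Binary.Construct.Closure.ReflexiveTransitive using (Star)

PropVar : Set
PropVar = ℕ

data MTree : Set where
  ⟨_⨾_⟩ : List PropVar → List (ℕ × MTree) → MTree

-- List operations (the paper's 1-based index i with 0 < i ≤ |Γ| is Fin (length Γ)).
-- #_i Γ  : lookup Γ i
-- Γ^{-i} : removeAt Γ i
-- Γ^{+i} = (#_i Γ) ⌢ Γ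
plusAt : {A : Set} (Γ : List A) → Fin (length Γ) → List A
plusAt Γ i = lookup Γ i ∷ Γ

setAt : {A : Set} (Γ : List A) → Fin (length Γ) → A → List A
setAt Γ i x = updateAt Γ i (λ _ → x)

length-setAt : {A : Set} (Γ : List A) (i : Fin (length Γ)) (x : A) →
               length (setAt Γ i x) ≡ length Γ
length-setAt (y ∷ Γ) zero    x = refl
length-setAt (y ∷ Γ) (suc i) x = cong suc (length-setAt Γ i x)

transpose : ∀ {n} → Fin n → Fin n → Fin n → Fin n
transpose i j k with k Data.Fin.≟ i | k Data.Fin.≟ j
... | yes _ | _     = j
... | no _  | yes _ = i
... | no _  | no _  = k

swapAt : {A : Set} (Γ : List A) → Fin (length Γ) → Fin (length Γ) → List A
swapAt Γ i j = tabulate (λ k → lookup Γ (transpose i j k))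

setRemoveAt : {A : Set} (Γ : List A) → Fin (length Γ) → A → Fin (length Γ) → List A
setRemoveAt Γ i x j = removeAt (setAt Γ i x) (cast (sym (length-setAt Γ i x)) j)

data σRoot : MTree → MTree → Set where
  σ-step : ∀ Δ Γ (i j : Fin (length Γ)) → i ≢ j →
           σRoot ⟨ Δ ⨾ Γ ⟩ ⟨ Δ ⨾ swapAt Γ i j ⟩

data π⁺Root : MTree → MTree → Set where
  π⁺-step : ∀ Δ Γ (i : Fin (length Γ)) →
            π⁺Root ⟨ Δ ⨾ Γ ⟩ ⟨ Δ ⨾ plusAt Γ i ⟩

data JRoot : MTree → MTree → Set where
  J-step : ∀ Δ Γ (i j : Fin (length Γ)) → i ≢ j →
           ∀ α Δ̃ Γ̃ β S →
           lookup Γ i ≡ (α , ⟨ Δ̃ ⨾ Γ̃ ⟩) →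
           lookup Γ j ≡ (β , S) →
           α > β →
           JRoot ⟨ Δ ⨾ Γ ⟩
                 ⟨ Δ ⨾ setRemoveAt Γ i (α , ⟨ Δ̃ ⨾ Γ̃ ++ [ (β , S) ] ⟩) j ⟩

-- Lifting a root step to an arbitrary position k ∈ Pos(T):
-- T ↪ T[S']_k where T|_k ↪_root S'.  Position ε is `here`; position i·r
-- rewrites inside the i-th child (edge label unchanged).
data AtPos (R : MTree → MTree → Set) : MTree → MTree → Set where
  here  : ∀ {T U} → R T U → AtPos R T U
  child : ∀ Δ Γ (i : Fin (length Γ)) {α S S'} →
          lookup Γ i ≡ (α , S) →
          AtPos R S S' →
          AtPos R ⟨ Δ ⨾ Γ ⟩ ⟨ Δ ⨾ setAt Γ i (α , S') ⟩

_↪σ_ _↪π⁺_ _↪J_ : MTree → MTree → Set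
_↪σ_  = AtPos σRoot
_↪π⁺_ = AtPos π⁺Root
_↪J_  = AtPos JRoot

_↪σ*_ _↪π⁺*_ _↪J*_ : MTree → MTree → Set
_↪σ*_  = Star _↪σ_
_↪π⁺*_ = Star _↪π⁺_
_↪J*_  = Star _↪J_

-- A J step followed by π⁺ steps cannot be commuted step by step: π⁺ may copy
-- the child that absorbed a sibling, or copy subtrees inside it.  Instead we
-- track a parallel J-reduction V ⇉ U, in which at every node of V some
-- siblings of smaller label are moved into a child, all at once.  A J step is
-- such a reduction, and every π⁺ step of U is simulated by π⁺ steps of V:
-- duplicating a child of U that absorbed siblings duplicates, in V, that child
-- together with all these siblings, and a step inside a moved sibling is
-- performed in V where the sibling still sits.  A parallel reduction is then
-- carried out by single J steps, one moved sibling at a time, and what remains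
-- is a difference in the order of children, which σ swaps repair.
module Submission where

open import Defs
open import Data.Empty using (⊥-elim)
open import Data.Fin using (Fin; zero; suc; cast; _≟_)
open import Data.Fin.Properties using (suc-injective; cast-is-id)
open import Data.List using (List; []; _∷_; _++_; [_]; length; lookup; removeAt)
open import Data.List.Membership.Propositional using (_∈_)
open import Data.List.Membership.Propositional.Properties
  using (∈-lookup; ∈-∃++; ∈-++⁺ˡ; ∈-++⁺ʳ; ∈-++⁻)
open import Data.List.Properties using (tabulate-cong; tabulate-lookup; ++-assoc; ++-identityʳ)
open import Data.List.Relation.Binary.Permutation.Propositional
open import Data.List.Relation.Binary.Permutation.Propositional.Properties
  using (∈-resp-↭; All-resp-↭; ++⁺ˡ; ++⁺ʳ; shift; shifts; drop-∷; ↭-empty-inv)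
  renaming (++-identityʳ to ↭-++-identityʳ)
open import Data.List.Relation.Unary.All as All using (All; []; _∷_)
open import Data.List.Relation.Unary.Any using (here; there; index)
open import Data.List.Relation.Unary.Any.Properties using (lookup-index)
open import Data.Nat using (ℕ; _<_)
open import Data.Product using (Σ; ∃; _×_; _,_; proj₁)
open import Data.Sum using (_⊎_; inj₁; inj₂)
open import Function using (_∘_)
open import Relation.Binary.Construct.Closure.ReflexiveTransitive using (Star; ε; _◅_; _◅◅_)
open import Relation.Binary.PropositionalEquality using (_≡_; _≢_; refl; sym; cong; subst)
import Relation.Binary.PropositionalEquality as ≡
open import Relation.Nullary using (¬_; yes; no)

module _ {A : Set} where

  ↭-∷-cancel : ∀ {xs ys zs : List A} {x} → xs ↭ x ∷ ys → xs ↭ x ∷ zs → ys ↭ zs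
  ↭-∷-cancel p q = drop-∷ (trans (↭-sym p) q)

  ∈⇒↭ : ∀ {x : A} {xs} → x ∈ xs → ∃ λ ys → xs ↭ x ∷ ys
  ∈⇒↭ x∈xs with ∈-∃++ x∈xs
  ... | ys , zs , refl = ys ++ zs , shift _ ys zs

  ∈⇒lookup : ∀ {x : A} {xs} → x ∈ xs → ∃ λ i → lookup xs i ≡ x
  ∈⇒lookup x∈xs = index x∈xs , sym (lookup-index x∈xs)

  lookup-↭ : ∀ {x} (xs : List A) (i : Fin (length xs)) → lookup xs i ≡ x → xs ↭ x ∷ removeAt xs i
  lookup-↭ (y ∷ xs) zero    refl = refl
  lookup-↭ (y ∷ xs) (suc i) e    = trans (prep y (lookup-↭ xs i e)) (swap y _ refl)

  setAt-↭ : (xs : List A) (i : Fin (length xs)) (y : A) → setAt xs i y ↭ y ∷ removeAt xs i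
  setAt-↭ (x ∷ xs) zero    y = refl
  setAt-↭ (x ∷ xs) (suc i) y = trans (prep x (setAt-↭ xs i y)) (swap x y refl)

  setAt-↭-∷ : ∀ {x ys} (xs : List A) (i : Fin (length xs)) (y : A) →
              lookup xs i ≡ x → xs ↭ x ∷ ys → setAt xs i y ↭ y ∷ ys
  setAt-↭-∷ xs i y e p = trans (setAt-↭ xs i y) (prep y (↭-∷-cancel (lookup-↭ xs i e) p))

  lookup∈removeAt : (xs : List A) (i j : Fin (length xs)) → i ≢ j → lookup xs j ∈ removeAt xs i
  lookup∈removeAt (x ∷ xs) zero    zero    i≢j = ⊥-elim (i≢j refl)
  lookup∈removeAt (x ∷ xs) zero    (suc j) _   = ∈-lookup j
  lookup∈removeAt (x ∷ xs) (suc i) zero    _   = here refl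
  lookup∈removeAt (x ∷ xs) (suc i) (suc j) i≢j = there (lookup∈removeAt xs i j (i≢j ∘ cong suc))

  ∈-removeAt⁻ : ∀ {x} (xs : List A) (i : Fin (length xs)) → x ∈ removeAt xs i →
                ∃ λ j → i ≢ j × lookup xs j ≡ x
  ∈-removeAt⁻ (y ∷ xs) zero x∈ =
    let (j , e) = ∈⇒lookup x∈ in suc j , (λ ()) , e
  ∈-removeAt⁻ (y ∷ xs) (suc i) (here refl) = zero , (λ ()) , refl
  ∈-removeAt⁻ (y ∷ xs) (suc i) (there x∈) =
    let (j , i≢j , e) = ∈-removeAt⁻ xs i x∈ in suc j , i≢j ∘ suc-injective , e

  lookup-setAt-≢ : (xs : List A) (i j : Fin (length xs)) (y : A) → i ≢ j →
                   lookup (setAt xs i y) (cast (sym (length-setAt xs i y)) j) ≡ lookup xs j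
  lookup-setAt-≢ (x ∷ xs) zero    zero    y i≢j = ⊥-elim (i≢j refl)
  lookup-setAt-≢ (x ∷ xs) zero    (suc j) y _   = cong (lookup xs) (cast-is-id _ j)
  lookup-setAt-≢ (x ∷ xs) (suc i) zero    y _   = refl
  lookup-setAt-≢ (x ∷ xs) (suc i) (suc j) y i≢j = lookup-setAt-≢ xs i j y (i≢j ∘ cong suc)

  setRemoveAt-↭ : ∀ {x ys} (xs : List A) (i j : Fin (length xs)) (y : A) → i ≢ j →
                  lookup xs j ≡ x → removeAt xs i ↭ x ∷ ys → setRemoveAt xs i y j ↭ y ∷ ys
  setRemoveAt-↭ xs i j y i≢j e p =
    ↭-∷-cancel (lookup-↭ (setAt xs i y) (cast (sym (length-setAt xs i y)) j)
                          (≡.trans (lookup-setAt-≢ xs i j y i≢j) e))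
               (trans (setAt-↭ xs i y) (trans (prep y p) (swap y _ refl)))

Child : Set
Child = ℕ × MTree

Below : ℕ → List Child → Set
Below α = All (λ c → proj₁ c < α)

child-↭ : ∀ {ρ Δ Γ α C C′ R} → Γ ↭ (α , C) ∷ R → AtPos ρ C C′ →
          ∃ λ Γ′ → AtPos ρ ⟨ Δ ⨾ Γ ⟩ ⟨ Δ ⨾ Γ′ ⟩ × Γ′ ↭ (α , C′) ∷ R
child-↭ {Δ = Δ} {Γ} p s =
  let (i , e) = ∈⇒lookup (∈-resp-↭ (↭-sym p) (here refl))
  in setAt Γ i _ , child Δ Γ i e s , setAt-↭-∷ Γ i _ e p

child-↭* : ∀ {ρ Δ Γ α C C′ R} → Γ ↭ (α , C) ∷ R → Star (AtPos ρ) C C′ →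
           ∃ λ Γ′ → Star (AtPos ρ) ⟨ Δ ⨾ Γ ⟩ ⟨ Δ ⨾ Γ′ ⟩ × Γ′ ↭ (α , C′) ∷ R
child-↭* p ε        = _ , ε , p
child-↭* p (s ◅ ss) =
  let (_ , s₁ , p₁)   = child-↭ p s
      (Γ₂ , ss₂ , p₂) = child-↭* p₁ ss
  in Γ₂ , s₁ ◅ ss₂ , p₂

transpose-suc : ∀ {n} (i j k : Fin n) → transpose (suc i) (suc j) (suc k) ≡ suc (transpose i j k)
transpose-suc i j k with k ≟ i | k ≟ j
... | yes _ | _     = refl
... | no _  | yes _ = refl
... | no _  | no _  = refl

swapAt-suc : ∀ {A : Set} (y : A) (xs : List A) (i j : Fin (length xs)) →
             swapAt (y ∷ xs) (suc i) (suc j) ≡ y ∷ swapAt xs i j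
swapAt-suc y xs i j = cong (y ∷_) (tabulate-cong (cong (lookup (y ∷ xs)) ∘ transpose-suc i j))

swapAt-01 : ∀ {A : Set} (x y : A) (xs : List A) → swapAt (x ∷ y ∷ xs) zero (suc zero) ≡ y ∷ x ∷ xs
swapAt-01 x y xs = cong (λ zs → y ∷ x ∷ zs) (tabulate-lookup xs)

σ-∷ : ∀ {Δ Δ′ Γ Γ′} y → ⟨ Δ ⨾ Γ ⟩ ↪σ ⟨ Δ′ ⨾ Γ′ ⟩ → ⟨ Δ ⨾ y ∷ Γ ⟩ ↪σ ⟨ Δ′ ⨾ y ∷ Γ′ ⟩
σ-∷ y (here (σ-step Δ Γ i j i≢j)) =
  subst (λ Γ′ → ⟨ Δ ⨾ y ∷ Γ ⟩ ↪σ ⟨ Δ ⨾ Γ′ ⟩) (swapAt-suc y Γ i j)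
        (here (σ-step Δ (y ∷ Γ) (suc i) (suc j) (i≢j ∘ suc-injective)))
σ-∷ y (child Δ Γ i e s) = child Δ (y ∷ Γ) (suc i) e s

σ*-∷ : ∀ {Δ Δ′ Γ Γ′} y → ⟨ Δ ⨾ Γ ⟩ ↪σ* ⟨ Δ′ ⨾ Γ′ ⟩ → ⟨ Δ ⨾ y ∷ Γ ⟩ ↪σ* ⟨ Δ′ ⨾ y ∷ Γ′ ⟩
σ*-∷ y ε                          = ε
σ*-∷ y (_◅_ {j = ⟨ _ ⨾ _ ⟩} s ss) = σ-∷ y s ◅ σ*-∷ y ss

σ-swap : ∀ {Δ} x y (Γ : List Child) → ⟨ Δ ⨾ x ∷ y ∷ Γ ⟩ ↪σ ⟨ Δ ⨾ y ∷ x ∷ Γ ⟩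
σ-swap {Δ} x y Γ =
  subst (λ Γ′ → ⟨ Δ ⨾ x ∷ y ∷ Γ ⟩ ↪σ ⟨ Δ ⨾ Γ′ ⟩) (swapAt-01 x y Γ)
        (here (σ-step Δ (x ∷ y ∷ Γ) zero (suc zero) (λ ())))

↭⇒σ* : ∀ {Δ Γ Γ′} → Γ ↭ Γ′ → ⟨ Δ ⨾ Γ ⟩ ↪σ* ⟨ Δ ⨾ Γ′ ⟩
↭⇒σ* refl                  = ε
↭⇒σ* (prep x p)            = σ*-∷ x (↭⇒σ* p)
↭⇒σ* (swap {xs = Γ} x y p) = σ-swap x y Γ ◅ σ*-∷ y (σ*-∷ x (↭⇒σ* p))
↭⇒σ* (trans p q)           = ↭⇒σ* p ◅◅ ↭⇒σ* q

π⁺-duplicate : ∀ {Δ Γ x} → x ∈ Γ → ⟨ Δ ⨾ Γ ⟩ ↪π⁺ ⟨ Δ ⨾ x ∷ Γ ⟩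
π⁺-duplicate {Δ} {Γ} x∈Γ =
  let (i , e) = ∈⇒lookup x∈Γ
  in subst (λ x → ⟨ Δ ⨾ Γ ⟩ ↪π⁺ ⟨ Δ ⨾ x ∷ Γ ⟩) e (here (π⁺-step Δ Γ i))

π⁺*-duplicatePrefix : ∀ {Δ Γ} L {R} → Γ ↭ L ++ R → ⟨ Δ ⨾ Γ ⟩ ↪π⁺* ⟨ Δ ⨾ L ++ Γ ⟩
π⁺*-duplicatePrefix []      p = ε
π⁺*-duplicatePrefix (x ∷ L) {R} p =
  π⁺*-duplicatePrefix L (trans p (↭-sym (shift x L R)))
    ◅◅ (π⁺-duplicate (∈-++⁺ʳ L (∈-resp-↭ (↭-sym p) (here refl))) ◅ ε)

J-↭ : ∀ {Δ Γ α Δ̃ Γ̃ β S R} → Γ ↭ (α , ⟨ Δ̃ ⨾ Γ̃ ⟩) ∷ (β , S) ∷ R → β < α →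
      ∃ λ Γ′ → ⟨ Δ ⨾ Γ ⟩ ↪J ⟨ Δ ⨾ Γ′ ⟩ × Γ′ ↭ (α , ⟨ Δ̃ ⨾ Γ̃ ++ [ (β , S) ] ⟩) ∷ R
J-↭ {Δ} {Γ} {α} {Δ̃} {Γ̃} {β} {S} p β<α =
  let (i , ei)       = ∈⇒lookup (∈-resp-↭ (↭-sym p) (here refl))
      rest           = ↭-∷-cancel (lookup-↭ Γ i ei) p
      (j , i≢j , ej) = ∈-removeAt⁻ Γ i (∈-resp-↭ (↭-sym rest) (here refl))
  in _ , here (J-step Δ Γ i j i≢j α Δ̃ Γ̃ β S ei ej β<α) , setRemoveAt-↭ Γ i j _ i≢j ej rest

J*-moveAll : ∀ {Δ Γ α Δ̃ Γ̃} ms {R} → Below α ms → Γ ↭ (α , ⟨ Δ̃ ⨾ Γ̃ ⟩) ∷ ms ++ R →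
             ∃ λ Γ′ → ⟨ Δ ⨾ Γ ⟩ ↪J* ⟨ Δ ⨾ Γ′ ⟩ × Γ′ ↭ (α , ⟨ Δ̃ ⨾ Γ̃ ++ ms ⟩) ∷ R
J*-moveAll {Γ = Γ} {α} {Δ̃} {Γ̃} [] {R} [] p =
  Γ , ε , subst (λ Γ̃′ → Γ ↭ (α , ⟨ Δ̃ ⨾ Γ̃′ ⟩) ∷ R) (sym (++-identityʳ Γ̃)) p
J*-moveAll {α = α} {Δ̃} {Γ̃} (m ∷ ms) {R} (m<α ∷ ms<α) p =
  let (_ , j₁ , p₁)  = J-↭ p m<α
      (Γ₂ , js , p₂) = J*-moveAll ms ms<α p₁
  in Γ₂ , j₁ ◅ js , subst (λ Γ̃′ → Γ₂ ↭ (α , ⟨ Δ̃ ⨾ Γ̃′ ⟩) ∷ R) (++-assoc Γ̃ [ m ] ms) p₂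

infix 4 _↝_

data _↝_ : List Child → List Child → Set where
  duplicate : ∀ {x Γ} → x ∈ Γ → Γ ↝ x ∷ Γ
  inside    : ∀ {Γ γ X X′ R} → Γ ↭ (γ , X) ∷ R → X ↪π⁺ X′ → Γ ↝ (γ , X′) ∷ R

[]-↝-impossible : ∀ {ms} → ¬ ([] ↝ ms)
[]-↝-impossible (duplicate ())
[]-↝-impossible (inside p _) with ↭-empty-inv (↭-sym p)
... | ()

↝-preserves-labels : ∀ {P : ℕ → Set} {ms ms′} → All (P ∘ proj₁) ms → ms ↝ ms′ → All (P ∘ proj₁) ms′
↝-preserves-labels ps (duplicate x∈ms) = All.lookup ps x∈ms ∷ ps
↝-preserves-labels ps (inside p _) with All-resp-↭ p ps
... | pγ ∷ pR = pγ ∷ pR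

↝-realise : ∀ {Δ Γ} P {ms ms′} Q → Γ ↭ P ++ ms ++ Q → ms ↝ ms′ →
            ∃ λ Γ′ → ⟨ Δ ⨾ Γ ⟩ ↪π⁺ ⟨ Δ ⨾ Γ′ ⟩ × Γ′ ↭ P ++ ms′ ++ Q
↝-realise P {ms} Q p (duplicate {x} x∈ms) =
  _ , π⁺-duplicate (∈-resp-↭ (↭-sym p) (∈-++⁺ʳ P (∈-++⁺ˡ x∈ms))) ,
  trans (prep x p) (↭-sym (shift x P (ms ++ Q)))
↝-realise P Q p (inside {R = R} q s) =
  let (Γ′ , s′ , p′) = child-↭ (trans p (trans (++⁺ˡ P (++⁺ʳ Q q)) (shift _ P (R ++ Q)))) s
  in Γ′ , s′ , trans p′ (↭-sym (shift _ P (R ++ Q)))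

-- V ⇉[ ms ] U: up to the order of children, U arises from V by moving at every
-- node, all at once, some children into a sibling of larger label, and by
-- appending ms, the siblings moved into the root from its parent.  In
-- Groups Γv Γr, Γv lists the children of V group by group, each group being a
-- child followed by the siblings moved into it, and Γr the resulting children.
infix 4 _⇉[_]_

data _⇉[_]_ : MTree → List Child → MTree → Set
data Groups : List Child → List Child → Set

data _⇉[_]_ where
  node : ∀ {Δ Γ Γv Γr ms Γ′} → Γ ↭ Γv → Groups Γv Γr → Γr ++ ms ↭ Γ′ →
         ⟨ Δ ⨾ Γ ⟩ ⇉[ ms ] ⟨ Δ ⨾ Γ′ ⟩

data Groups where
  []    : Groups [] []
  group : ∀ {α C ms C′ Γv Γr} → C ⇉[ ms ] C′ → Below α ms → Groups Γv Γr →
          Groups ((α , C) ∷ ms ++ Γv) ((α , C′) ∷ Γr)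

⇉-refl : ∀ T → T ⇉[ [] ] T
Groups-refl : ∀ Γ → Groups Γ Γ
⇉-refl ⟨ Δ ⨾ Γ ⟩ = node refl (Groups-refl Γ) (↭-++-identityʳ Γ)
Groups-refl []            = []
Groups-refl ((α , X) ∷ Γ) = group (⇉-refl X) [] (Groups-refl Γ)

J⇒⇉ : ∀ {T U} → T ↪J U → T ⇉[ [] ] U
J⇒⇉ (here (J-step Δ Γ i j i≢j α Δ̃ Γ̃ β S ei ej β<α)) =
  let (R , r) = ∈⇒↭ (subst (_∈ removeAt Γ i) ej (lookup∈removeAt Γ i j i≢j))
  in node (trans (lookup-↭ Γ i ei) (prep _ r))
          (group (node refl (Groups-refl Γ̃) refl) (β<α ∷ []) (Groups-refl R))
          (trans (↭-++-identityʳ _) (↭-sym (setRemoveAt-↭ Γ i j _ i≢j ej r)))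
J⇒⇉ (child Δ Γ i e s) =
  node (lookup-↭ Γ i e) (group (J⇒⇉ s) [] (Groups-refl (removeAt Γ i)))
       (trans (↭-++-identityʳ _) (↭-sym (setAt-↭ Γ i _)))

data Focus (Γv Γr : List Child) (α : ℕ) (S : MTree) : Set where
  focus : ∀ {C ms Γv₀ Γr₀} → C ⇉[ ms ] S → Below α ms → Groups Γv₀ Γr₀ →
          Γv ↭ (α , C) ∷ ms ++ Γv₀ → Γr ↭ (α , S) ∷ Γr₀ → Focus Γv Γr α S

Groups-focus : ∀ {Γv Γr α S} → Groups Γv Γr → (α , S) ∈ Γr → Focus Γv Γr α S
Groups-focus (group d b gs) (here refl) = focus d b gs refl refl
Groups-focus (group {β} {D} {ns} d b gs) (there x∈) with Groups-focus gs x∈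
... | focus {C} {ms} d′ b′ gs′ sv sr =
  focus d′ b′ (group d b gs′)
        (trans (++⁺ˡ ((β , D) ∷ ns) sv) (shifts ((β , D) ∷ ns) ((_ , C) ∷ ms)))
        (trans (prep _ sr) (swap _ _ refl))

-- Either V catches up by π⁺ steps, or the step acted on a sibling moved in from
-- the parent, which the parent then has to perform.
Simulation : MTree → List Child → MTree → Set
Simulation V ms U′ = (∃ λ V′ → V ↪π⁺* V′ × V′ ⇉[ ms ] U′) ⊎ (∃ λ ms′ → ms ↝ ms′ × V ⇉[ ms′ ] U′)

⇉-π⁺ : ∀ {V ms U U′} → V ⇉[ ms ] U → U ↪π⁺ U′ → Simulation V ms U′
⇉-π⁺-inside : ∀ {Δ Γ Γv Γr ms α S S′ R Γ′} → Γ ↭ Γv → Groups Γv Γr →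
              Γr ++ ms ↭ (α , S) ∷ R → S ↪π⁺ S′ → (α , S′) ∷ R ↭ Γ′ →
              Simulation ⟨ Δ ⨾ Γ ⟩ ms ⟨ Δ ⨾ Γ′ ⟩
group-π⁺ : ∀ {Δ Γ α C ms Γv Γr S S′ ms₀ Γ′} → Γ ↭ (α , C) ∷ ms ++ Γv →
           C ⇉[ ms ] S → Below α ms → Groups Γv Γr → S ↪π⁺ S′ → (α , S′) ∷ Γr ++ ms₀ ↭ Γ′ →
           ∃ λ V′ → ⟨ Δ ⨾ Γ ⟩ ↪π⁺* V′ × V′ ⇉[ ms₀ ] ⟨ Δ ⨾ Γ′ ⟩

⇉-π⁺ (node {Γr = Γr} p gs q) (here (π⁺-step Δ Γ′ i))
  with ∈-++⁻ Γr (∈-resp-↭ (↭-sym q) (∈-lookup i))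
... | inj₂ x∈ms = inj₂ (_ , duplicate x∈ms , node p gs (trans (shift _ Γr _) (prep _ q)))
... | inj₁ x∈Γr with Groups-focus gs x∈Γr
... | focus {C} {ms} d b _ sv _ =
  inj₁ (_ , π⁺*-duplicatePrefix ((_ , C) ∷ ms) (trans p sv) ,
        node (++⁺ˡ ((_ , C) ∷ ms) p) (group d b gs) (prep _ q))
⇉-π⁺ (node p gs q) (child Δ Γ′ i e s) =
  ⇉-π⁺-inside p gs (trans q (lookup-↭ Γ′ i e)) s (↭-sym (setAt-↭ Γ′ i _))

⇉-π⁺-inside {Γr = Γr} p gs q s r with ∈-++⁻ Γr (∈-resp-↭ (↭-sym q) (here refl))
... | inj₁ x∈Γr with Groups-focus gs x∈Γr
...   | focus d b gs₀ sv sr =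
  inj₁ (group-π⁺ (trans p sv) d b gs₀ s (trans (prep _ (↭-∷-cancel (++⁺ʳ _ sr) q)) r))
⇉-π⁺-inside {Γr = Γr} p gs q s r | inj₂ x∈ms =
  let (R′ , m) = ∈⇒↭ x∈ms
      moved    = trans (++⁺ˡ Γr m) (shift _ Γr R′)
  in inj₂ (_ , inside m s , node p gs (trans (shift _ Γr R′) (trans (prep _ (↭-∷-cancel moved q)) r)))

group-π⁺ p d b gs s q with ⇉-π⁺ d s
... | inj₁ (_ , ss , d′) =
  let (_ , ss₁ , p₁) = child-↭* p ss in _ , ss₁ , node p₁ (group d′ b gs) q
... | inj₂ (_ , st , d′) =
  let (_ , s₁ , p₁) = ↝-realise [ _ ] _ p st
  in _ , s₁ ◅ ε , node p₁ (group d′ (↝-preserves-labels b st) gs) q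

⇉-π⁺* : ∀ {V U U′} → V ⇉[ [] ] U → U ↪π⁺* U′ → ∃ λ V′ → V ↪π⁺* V′ × V′ ⇉[ [] ] U′
⇉-π⁺* d ε = _ , ε , d
⇉-π⁺* d (s ◅ ss) with ⇉-π⁺ d s
... | inj₁ (_ , vs₁ , d₁) = let (V₂ , vs₂ , d₂) = ⇉-π⁺* d₁ ss in V₂ , vs₁ ◅◅ vs₂ , d₂
... | inj₂ (_ , st , _)   = ⊥-elim ([]-↝-impossible st)

-- The movers are moved in first, so that the J steps inside a child act on a
-- node that already contains them.
⇉-appended⇒J*σ* : ∀ {Δ Γ Γ′ ms U} → ⟨ Δ ⨾ Γ ⟩ ⇉[ ms ] U → Γ′ ↭ Γ ++ ms →
                  ∃ λ W → ⟨ Δ ⨾ Γ′ ⟩ ↪J* W × W ↪σ* U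
Groups⇒J*σ* : ∀ {Δ Γ Γv Γr Ctx} → Groups Γv Γr → Γ ↭ Γv ++ Ctx →
              ∃ λ Γw → ⟨ Δ ⨾ Γ ⟩ ↪J* ⟨ Δ ⨾ Γw ⟩ × ⟨ Δ ⨾ Γw ⟩ ↪σ* ⟨ Δ ⨾ Γr ++ Ctx ⟩

⇉-appended⇒J*σ* {ms = ms} (node p gs q) r =
  let (_ , js , σs) = Groups⇒J*σ* gs (trans r (++⁺ʳ ms p)) in _ , js , σs ◅◅ ↭⇒σ* q

Groups⇒J*σ* [] p = _ , ε , ↭⇒σ* p
Groups⇒J*σ* {Ctx = Ctx} (group {C = ⟨ _ ⨾ _ ⟩} {ms} {Γv = Γv} {Γr} d b gs) p =
  let (_ , js₁ , p₁)   = J*-moveAll ms b (trans p (prep _ (↭-reflexive (++-assoc ms Γv Ctx))))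
      (_ , js , σs)    = ⇉-appended⇒J*σ* d refl
      (_ , js₂ , p₂)   = child-↭* p₁ js
      (Γw , js₃ , σs₃) = Groups⇒J*σ* gs (trans p₂ (↭-sym (shift _ Γv Ctx)))
      (_ , σs₄ , p₄)   = child-↭* (shift _ Γr Ctx) σs
  in Γw , js₁ ◅◅ js₂ ◅◅ js₃ , σs₃ ◅◅ σs₄ ◅◅ ↭⇒σ* p₄

⇉⇒J*σ* : ∀ {V U} → V ⇉[ [] ] U → ∃ λ W → V ↪J* W × W ↪σ* U
⇉⇒J*σ* d@(node {Γ = Γ} _ _ _) = ⇉-appended⇒J*σ* d (↭-sym (↭-++-identityʳ Γ))

mainTheorem8 : (T S : MTree) →
    Σ MTree (λ U → T ↪J U × U ↪π⁺* S) →
    Σ MTree (λ V → Σ MTree (λ W → T ↪π⁺* V × V ↪J* W × W ↪σ* S))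
mainTheorem8 T S (U , T↪U , U↪*S) =
  let (V , T↪*V , V⇉S) = ⇉-π⁺* (J⇒⇉ T↪U) U↪*S
      (W , V↪*W , W↪*S) = ⇉⇒J*σ* V⇉S
  in V , W , T↪*V , V↪*W , W↪*S
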